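{- Let $\mathcal{A}$ be a deterministic parity automaton over $\{0,1\}^3$ with state set $Q$, and let $I=Q\cup Q\times\{0,1\}$. For every monadic second-order formula $\psi(X^1,\dots,X^k)$ over the signature $\tau_{\mathcal{A}}$ with free set variables $X^1,\dots,X^k$, there is an MLO formula $\varphi(Y,\overrightarrow{Z^1},\dots,\overrightarrow{Z^k})$ over $\{<\}$, where $\overrightarrow{Z^j}=(Z^j_i)_{i\in I}$ are set variables, such that for every $\mathbf{P}\subseteq\mathbb{N}$ and every family $(W^j_i)_{j\le k,\,i\in I}$ of subsets of $\mathbb{N}$: $\langle\mathbb{N},<\rangle\models\varphi(\mathbf{P},\dots,W^j_i,\dots)$ iff $M_{\mathcal{A},\mathbf{P}}\models\psi(S^1,\dots,S^k)$, where $S^j$ is the set of nodes of $G_{\mathcal{A},\mathbf{P}}$ corresponding to $(W^j_i)_{i\in I}$. Moreover, there is an algorithm computing $\varphi$ from $\psi$ (and $\mathcal{A}$).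
   Context: A deterministic parity automaton $\mathcal{A}=\langle Q,\Sigma,\delta,q_{init},col\rangle$ has finite state set $Q$, $\delta:Q\times\Sigma\to Q$, $q_{init}\in Q$, $col:Q\to\mathbb{N}$. MLO is monadic second-order logic over $<$ (and unary predicates) on $\mathbb{N}$. Graph $G_{\mathcal{A},\mathbf{P}}$ ($\mathbf{P}\subseteq\mathbb{N}$): nodes $V_1=Q\times\mathbb{N}$ and $V_2=Q\times\{0,1\}\times\mathbb{N}$. From $\langle q,n\rangle$ an edge labelled $0$ goes to $\langle q,0,n\rangle$ and one labelled $1$ to $\langle q,1,n\rangle$. From $\langle q,a,n\rangle$, with $c=1$ if $n\in\mathbf{P}$ and $c=0$ otherwise, an edge labelled $b$ goes to $\langle\delta(q,\langle a,b,c\rangle),n+1\rangle$ ($b\in\{0,1\}$). The structure $M_{\mathcal{A},\mathbf{P}}$ has universe $V_1\cup V_2$ and signature $\tau_{\mathcal{A}}=\{R_i:i\in I\}\cup\{\mathit{Init},P,\prec,E_0,E_1\}$ interpreted by $R_q=\{\langle q,j\rangle:j\in\mathbb{N}\}$, $R_{\langle q,a\rangle}=\{\langle q,a,j\rangle:j\in\mathbb{N}\}$, $P=\{\langle q,m\rangle,\langle q,a,m\rangle:m\in\mathbf{P}\}$, $\mathit{Init}=\{\langle q_{init},0\rangle\}$, $E_b(v_1,v_2)$ iff there is an edge labelled $b$ from $v_1$ to $v_2$, and $v_1\prec v_2$ iff the last ($\mathbb{N}$-)coordinate of $v_1$ is smaller than that of $v_2$; set variables range over sets of nodes. A set $S$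 of nodes corresponds to the tuple $(W_i)_{i\in I}$ of subsets of $\mathbb{N}$ where $\langle q,m\rangle\in S$ iff $m\in W_q$, and $\langle q,a,m\rangle\in S$ iff $m\in W_{\langle q,a\rangle}$. -}

module Defs where

open import Data.Nat using (ℕ; zero; suc; _<_)
open import Data.Fin using (Fin)
open import Data.Bool using (Bool; true; false)
open import Data.Maybe using (Maybe; just; nothing; maybe)
open import Data.Product using (Σ; _×_; _,_)
open import Data.Sum using (_⊎_; inj₁; inj₂)
open import Data.Empty using (⊥)
open import Relation.Nullary using (¬_)
open import Relation.Binary.PropositionalEquality using (_≡_)

Letter : Set
Letter = Bool × Bool × Bool

record DPA : Set where
  field
    nQ    : ℕ
    δ     : Fin nQ → Letter → Fin nQ
    qinit : Fin nQ
    col   : Fin nQ → ℕ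

module _ (A : DPA) where
  open DPA A

  Q : Set
  Q = Fin nQ

  I : Set
  I = Q ⊎ (Q × Bool)

  Node : Set
  Node = (Q × ℕ) ⊎ (Q × Bool × ℕ)

pos : {A : DPA} → Node A → ℕ
pos (inj₁ (q , n))     = n
pos (inj₂ (q , a , n)) = n

toNodeSet : {A : DPA} → (I A → ℕ → Bool) → Node A → Bool
toNodeSet W (inj₁ (q , m))     = W (inj₁ q) m
toNodeSet W (inj₂ (q , a , m)) = W (inj₂ (q , a)) m

-- The graph G_{A,P} and structure M_{A,P}; P ⊆ ℕ given as ℕ → Bool
-- (c = 1 iff n ∈ P, i.e. c = P n).

data Edge (A : DPA) (P : ℕ → Bool) : Bool → Node A → Node A → Set where
  edge₁ : ∀ q a n → Edge A P a (inj₁ (q , n)) (inj₂ (q , a , n))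
  edge₂ : ∀ q a b n →
          Edge A P b (inj₂ (q , a , n))
                     (inj₁ (DPA.δ A q (a , b , P n) , suc n))

-- MSO over τ_A.  F = type of free first-order (node) variables,
-- S = type of free set variables.

data MSO (A : DPA) (F S : Set) : Set where
  R     : I A → F → MSO A F S
  Init  : F → MSO A F S
  Pr    : F → MSO A F S
  _≺_   : F → F → MSO A F S
  E     : Bool → F → F → MSO A F S
  _≐_   : F → F → MSO A F S
  _∈_   : F → S → MSO A F S
  ¬′_   : MSO A F S → MSO A F S
  _∧′_  : MSO A F S → MSO A F S → MSO A F S
  _∨′_  : MSO A F S → MSO A F S → MSO A F S
  ∃₁ ∀₁ : MSO A (Maybe F) S → MSO A F S
  ∃₂ ∀₂ : MSO A F (Maybe S) → MSO A F S

Rel : (A : DPA) → I A → Node A → Set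
Rel A (inj₁ q)       v = Σ ℕ λ j → v ≡ inj₁ (q , j)
Rel A (inj₂ (q , a)) v = Σ ℕ λ j → v ≡ inj₂ (q , a , j)

sat : (A : DPA) (P : ℕ → Bool) {F S : Set} →
      MSO A F S → (F → Node A) → (S → Node A → Bool) → Set
sat A P (R i x)    ρ σ = Rel A i (ρ x)
sat A P (Init x)   ρ σ = ρ x ≡ inj₁ (DPA.qinit A , zero)
sat A P (Pr x)     ρ σ = P (pos {A} (ρ x)) ≡ true
sat A P (x ≺ y)    ρ σ = pos {A} (ρ x) < pos {A} (ρ y)
sat A P (E b x y)  ρ σ = Edge A P b (ρ x) (ρ y)
sat A P (x ≐ y)    ρ σ = ρ x ≡ ρ y
sat A P (x ∈ X)    ρ σ = σ X (ρ x) ≡ true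
sat A P (¬′ ψ)     ρ σ = ¬ sat A P ψ ρ σ
sat A P (ψ ∧′ χ)   ρ σ = sat A P ψ ρ σ × sat A P χ ρ σ
sat A P (ψ ∨′ χ)   ρ σ = sat A P ψ ρ σ ⊎ sat A P χ ρ σ
sat A P (∃₁ ψ)     ρ σ = Σ (Node A) λ v → sat A P ψ (maybe ρ v) σ
sat A P (∀₁ ψ)     ρ σ = (v : Node A) → sat A P ψ (maybe ρ v) σ
sat A P (∃₂ ψ)     ρ σ = Σ (Node A → Bool) λ T → sat A P ψ ρ (maybe σ T)
sat A P (∀₂ ψ)     ρ σ = (T : Node A → Bool) → sat A P ψ ρ (maybe σ T)

data MLO (F S : Set) : Set where
  _<′_  : F → F → MLO F S
  _≐′_  : F → F → MLO F S
  _∈′_  : F → S → MLO F S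
  ¬′_   : MLO F S → MLO F S
  _∧′_  : MLO F S → MLO F S → MLO F S
  _∨′_  : MLO F S → MLO F S → MLO F S
  ∃₁ ∀₁ : MLO (Maybe F) S → MLO F S
  ∃₂ ∀₂ : MLO F (Maybe S) → MLO F S

satℕ : {F S : Set} → MLO F S → (F → ℕ) → (S → ℕ → Bool) → Set
satℕ (x <′ y)  ρ σ = ρ x < ρ y
satℕ (x ≐′ y)  ρ σ = ρ x ≡ ρ y
satℕ (x ∈′ X)  ρ σ = σ X (ρ x) ≡ true
satℕ (¬′ φ)    ρ σ = ¬ satℕ φ ρ σ
satℕ (φ ∧′ χ)  ρ σ = satℕ φ ρ σ × satℕ χ ρ σ
satℕ (φ ∨′ χ)  ρ σ = satℕ φ ρ σ ⊎ satℕ χ ρ σ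
satℕ (∃₁ φ)    ρ σ = Σ ℕ λ n → satℕ φ (maybe ρ n) σ
satℕ (∀₁ φ)    ρ σ = (n : ℕ) → satℕ φ (maybe ρ n) σ
satℕ (∃₂ φ)    ρ σ = Σ (ℕ → Bool) λ T → satℕ φ ρ (maybe σ T)
satℕ (∀₂ φ)    ρ σ = (T : ℕ → Bool) → satℕ φ ρ (maybe σ T)

noVars : {B : Set} → ⊥ → B
noVars ()

-- Set-variable environment for φ(Y, Z⃗¹, …, Z⃗ᵏ):
-- nothing ↦ Y := P,  just (j , i) ↦ Z^j_i := W^j_i.
mloEnv : {A : DPA} {k : ℕ} → (ℕ → Bool) → (Fin k → I A → ℕ → Bool) →
         Maybe (Fin k × I A) → ℕ → Bool
mloEnv P W nothing        = P
mloEnv P W (just (j , i)) = W j i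

-- The structure M_{A,P} is interpreted in ⟨ℕ,<,P⟩ with one copy of ℕ for
-- every index i ∈ I: node ⟨i,n⟩ is the n-th element of copy i.  A node
-- variable therefore becomes a position variable together with its index,
-- which is a finite piece of data that the translation guesses by a finite
-- disjunction (or conjunction) over I; a set of nodes becomes the I-indexed
-- family of its slices, quantified by a block of |I| = 3|Q| set quantifiers.
-- The edge relations only compare positions n and n+1 and the bit n ∈ P, so
-- they are expressible with < and the set variable Y holding P.

module Submission where

open import Defs
open import Data.Bool using (Bool; true; false)
import Data.Bool as Bool
open import Data.Empty using (⊥; ⊥-elim)
open import Data.Fin using (Fin; zero; suc)
import Data.Fin as Fin
open import Data.Maybe using (Maybe; just; nothing; maybe)
open import Data.Nat using (ℕ; zero; suc; _<_)
open import Data.Nat.Properties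
  using (≤-pred; <⇒≱; ≮⇒≥; m≤n⇒m<n∨m≡n; m<n⇒n≢0; n≤0⇒n≡0; n<1+n)
open import Data.Product using (Σ; ∃; _×_; _,_; proj₁; proj₂; assocʳ; assocˡ)
open import Data.Product.Function.NonDependent.Propositional using (_×-⇔_)
import Data.Product.Properties as Product
open import Data.Sum using (_⊎_; inj₁; inj₂)
open import Data.Sum.Function.Propositional using (_⊎-⇔_)
import Data.Sum.Properties as Sum
open import Data.Vec.Functional using (Vector; _∷_; head; tail)
open import Function using (_∘_)
open import Function.Bundles using (_⇔_; mk⇔; Equivalence)
open import Function.Construct.Identity using (⇔-id)
import Function.Properties.Equivalence as ⇔
open import Function.Related.TypeIsomorphisms using (¬-cong-⇔)
open import Relation.Binary.PropositionalEquality
  using (_≡_; refl; sym; trans; subst; cong-app; _≗_)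
open import Relation.Nullary using (¬_; Dec; yes; no)

open Equivalence using (to; from)

module _ {X Y : Set} (R : X → Y → Set)
         (left-total : ∀ x → ∃ (R x)) (right-total : ∀ y → ∃ λ x → R x y)
         {A : X → Set} {B : Y → Set} (A⇔B : ∀ {x y} → R x y → A x ⇔ B y) where

  Σ-⇔-related : Σ X A ⇔ Σ Y B
  Σ-⇔-related = mk⇔
    (λ (x , a) → let (y , r) = left-total x in y , to (A⇔B r) a)
    (λ (y , b) → let (x , r) = right-total y in x , from (A⇔B r) b)

  Π-⇔-related : ((x : X) → A x) ⇔ ((y : Y) → B y)
  Π-⇔-related = mk⇔
    (λ f y → let (x , r) = right-total y in to (A⇔B r) (f x))
    (λ g x → let (y , r) = left-total x in from (A⇔B r) (g y))

Ext : ℕ → Set → Set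
Ext zero    S = S
Ext (suc m) S = Ext m (Maybe S)

weaken : ∀ {S} m → S → Ext m S
weaken zero    s = s
weaken (suc m) s = weaken m (just s)

fresh : ∀ {S} m → Fin m → Ext m S
fresh (suc m) zero    = weaken m nothing
fresh (suc m) (suc j) = fresh m j

extend : ∀ {S X : Set} m → (S → X) → Vector X m → Ext m S → X
extend zero    σ T = σ
extend (suc m) σ T = extend m (maybe σ (head T)) (tail T)

extend-weaken : ∀ {S X : Set} m (σ : S → X) T s → extend m σ T (weaken m s) ≡ σ s
extend-weaken zero    σ T s = refl
extend-weaken (suc m) σ T s = extend-weaken m _ _ (just s)

extend-fresh : ∀ {S X : Set} m (σ : S → X) T j → extend m σ T (fresh m j) ≡ T j
extend-fresh (suc m) σ T zero    = extend-weaken m _ _ nothing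
extend-fresh (suc m) σ T (suc j) = extend-fresh m _ _ j

module _ {F S : Set} where

  ⊤′ ⊥′ : MLO F S
  ⊤′ = ∀₁ (nothing ≐′ nothing)
  ⊥′ = ∃₁ (¬′ (nothing ≐′ nothing))

  ⊥′-unsat : ∀ ρ σ → ¬ satℕ ⊥′ ρ σ
  ⊥′-unsat ρ σ (_ , n≢n) = n≢n refl

  ⌊_⌋′ : {X : Set} → Dec X → MLO F S
  ⌊ yes _ ⌋′ = ⊤′
  ⌊ no  _ ⌋′ = ⊥′

  ⌊⌋′-sat : {X : Set} (d : Dec X) → ∀ ρ σ → satℕ ⌊ d ⌋′ ρ σ ⇔ X
  ⌊⌋′-sat (yes x) ρ σ = mk⇔ (λ _ → x) (λ _ _ → refl)
  ⌊⌋′-sat (no ¬x) ρ σ = mk⇔ (⊥-elim ∘ ⊥′-unsat ρ σ) (⊥-elim ∘ ¬x)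

  ⋁ ⋀ : ∀ m → Vector (MLO F S) m → MLO F S
  ⋁ zero    φ = ⊥′
  ⋁ (suc m) φ = head φ ∨′ ⋁ m (tail φ)
  ⋀ zero    φ = ⊤′
  ⋀ (suc m) φ = head φ ∧′ ⋀ m (tail φ)

  ⋁-sat : ∀ m φ ρ σ → satℕ (⋁ m φ) ρ σ ⇔ ∃ λ j → satℕ (φ j) ρ σ
  ⋁-sat zero    φ ρ σ = mk⇔ (⊥-elim ∘ ⊥′-unsat ρ σ) λ ()
  ⋁-sat (suc m) φ ρ σ = mk⇔
    (λ { (inj₁ h) → zero , h ; (inj₂ h) → let (j , h′) = to IH h in suc j , h′ })
    (λ { (zero , h) → inj₁ h ; (suc j , h) → inj₂ (from IH (j , h)) })
    where IH = ⋁-sat m (tail φ) ρ σ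

  ⋀-sat : ∀ m φ ρ σ → satℕ (⋀ m φ) ρ σ ⇔ (∀ j → satℕ (φ j) ρ σ)
  ⋀-sat zero    φ ρ σ = mk⇔ (λ _ ()) (λ _ _ → refl)
  ⋀-sat (suc m) φ ρ σ = mk⇔
    (λ { (h , hs) zero → h ; (h , hs) (suc j) → to IH hs j })
    (λ h → h zero , from IH (h ∘ suc))
    where IH = ⋀-sat m (tail φ) ρ σ

  isZero : F → MLO F S
  isZero x = ∀₁ (¬′ (nothing <′ just x))

  isZero-sat : ∀ x ρ σ → satℕ (isZero x) ρ σ ⇔ (ρ x ≡ 0)
  isZero-sat x ρ σ = mk⇔ (λ h → n≤0⇒n≡0 (≮⇒≥ (h 0))) (λ x≡0 n n<x → m<n⇒n≢0 n<x x≡0)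

  isSucc : F → F → MLO F S
  isSucc x z = (x <′ z) ∧′ (¬′ ∃₁ ((just x <′ nothing) ∧′ (nothing <′ just z)))

  isSucc-sat : ∀ x z ρ σ → satℕ (isSucc x z) ρ σ ⇔ (ρ z ≡ suc (ρ x))
  isSucc-sat x z ρ σ = mk⇔ sound complete
    where
    sound : satℕ (isSucc x z) ρ σ → ρ z ≡ suc (ρ x)
    sound (x<z , nothing-between) with m≤n⇒m<n∨m≡n x<z
    ... | inj₁ sx<z = ⊥-elim (nothing-between (suc (ρ x) , n<1+n (ρ x) , sx<z))
    ... | inj₂ sx≡z = sym sx≡z
    complete : ρ z ≡ suc (ρ x) → satℕ (isSucc x z) ρ σ
    complete z≡sx rewrite z≡sx = n<1+n (ρ x) , λ (_ , x<n , n<sx) → <⇒≱ x<n (≤-pred n<sx)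

  case∈ : F → S → (Bool → MLO F S) → MLO F S
  case∈ x y φ = ((x ∈′ y) ∧′ φ true) ∨′ ((¬′ (x ∈′ y)) ∧′ φ false)

  case∈-sat : ∀ x y φ ρ σ (X : Bool → Set) → (∀ c → satℕ (φ c) ρ σ ⇔ X c) →
              satℕ (case∈ x y φ) ρ σ ⇔ X (σ y (ρ x))
  case∈-sat x y φ ρ σ X φ⇔X with σ y (ρ x)
  ... | true  = mk⇔ (λ { (inj₁ (_ , h)) → to (φ⇔X true) h ; (inj₂ (t≢t , _)) → ⊥-elim (t≢t refl) })
                    (λ h → inj₁ (refl , from (φ⇔X true) h))
  ... | false = mk⇔ (λ { (inj₁ (() , _)) ; (inj₂ (_ , h)) → to (φ⇔X false) h })
                    (λ h → inj₂ ((λ ()) , from (φ⇔X false) h))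

∃ⁿ ∀ⁿ : ∀ {F S} m → MLO F (Ext m S) → MLO F S
∃ⁿ zero    φ = φ
∃ⁿ (suc m) φ = ∃₂ (∃ⁿ m φ)
∀ⁿ zero    φ = φ
∀ⁿ (suc m) φ = ∀₂ (∀ⁿ m φ)

∃ⁿ-sat : ∀ {F S} m (φ : MLO F (Ext m S)) ρ σ →
         satℕ (∃ⁿ m φ) ρ σ ⇔ Σ (Vector (ℕ → Bool) m) λ T → satℕ φ ρ (extend m σ T)
∃ⁿ-sat zero    φ ρ σ = mk⇔ (λ h → (λ ()) , h) proj₂
∃ⁿ-sat (suc m) φ ρ σ = mk⇔
  (λ (T₀ , h) → let (T , h′) = to (∃ⁿ-sat m φ ρ _) h in T₀ ∷ T , h′)
  (λ (T , h) → head T , from (∃ⁿ-sat m φ ρ _) (tail T , h))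

∀ⁿ-sat : ∀ {F S} m (φ : MLO F (Ext m S)) ρ σ →
         satℕ (∀ⁿ m φ) ρ σ ⇔ ((T : Vector (ℕ → Bool) m) → satℕ φ ρ (extend m σ T))
∀ⁿ-sat zero    φ ρ σ = mk⇔ (λ h _ → h) (λ h → h (λ ()))
∀ⁿ-sat (suc m) φ ρ σ = mk⇔
  (λ h T → to (∀ⁿ-sat m φ ρ _) (h (head T)) (tail T))
  (λ h T₀ → from (∀ⁿ-sat m φ ρ _) (λ T → h (T₀ ∷ T)))

module _ (A : DPA) where
  open DPA A

  node : I A → ℕ → Node A
  node (inj₁ q)       n = inj₁ (q , n)
  node (inj₂ (q , a)) n = inj₂ (q , a , n)

  index : Node A → I A
  index (inj₁ (q , _))     = inj₁ q
  index (inj₂ (q , a , _)) = inj₂ (q , a)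

  node-index-pos : ∀ v → node (index v) (pos {A} v) ≡ v
  node-index-pos (inj₁ _) = refl
  node-index-pos (inj₂ _) = refl

  pos-node : ∀ i n → pos {A} (node i n) ≡ n
  pos-node (inj₁ _) n = refl
  pos-node (inj₂ _) n = refl

  toNodeSet-node : (W : I A → ℕ → Bool) → ∀ i → W i ≗ toNodeSet {A} W ∘ node i
  toNodeSet-node W (inj₁ _) n = refl
  toNodeSet-node W (inj₂ _) n = refl

  _≟ᴵ_ : (i j : I A) → Dec (i ≡ j)
  _≟ᴵ_ = Sum.≡-dec Fin._≟_ (Product.≡-dec Fin._≟_ Bool._≟_)

  ≡×≡⇔node≡node : ∀ i j n m → (i ≡ j × n ≡ m) ⇔ (node i n ≡ node j m)
  ≡×≡⇔node≡node i j n m = mk⇔ (λ { (refl , refl) → refl }) (injective i j)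
    where
    injective : ∀ i j → node i n ≡ node j m → i ≡ j × n ≡ m
    injective (inj₁ _) (inj₁ _) refl = refl , refl
    injective (inj₂ _) (inj₂ _) refl = refl , refl

  ≡⇔Rel-node : ∀ j i n → (j ≡ i) ⇔ Rel A i (node j n)
  ≡⇔Rel-node j i n = mk⇔ (λ { refl → complete j }) (sound j i)
    where
    complete : ∀ j → Rel A j (node j n)
    complete (inj₁ _) = n , refl
    complete (inj₂ _) = n , refl
    sound : ∀ j i → Rel A i (node j n) → j ≡ i
    sound (inj₁ _) (inj₁ _) (_ , refl) = refl
    sound (inj₂ _) (inj₂ _) (_ , refl) = refl

  _codes_ : I A × ℕ → Node A → Set
  (i , n) codes v = node i n ≡ v

  _codesSet_ : (I A → ℕ → Bool) → (Node A → Bool) → Set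
  W codesSet T = ∀ i → W i ≗ T ∘ node i

  Σ-⇔-nodes : {B : I A × ℕ → Set} {C : Node A → Set} →
              (∀ i n → B (i , n) ⇔ C (node i n)) → Σ (I A × ℕ) B ⇔ Σ (Node A) C
  Σ-⇔-nodes B⇔C = Σ-⇔-related _codes_ (λ c → _ , refl) (λ v → _ , node-index-pos v)
                                       (λ { {i , n} refl → B⇔C i n })

  Π-⇔-nodes : {B : I A × ℕ → Set} {C : Node A → Set} →
              (∀ i n → B (i , n) ⇔ C (node i n)) → (∀ c → B c) ⇔ (∀ v → C v)
  Π-⇔-nodes B⇔C = Π-⇔-related _codes_ (λ c → _ , refl) (λ v → _ , node-index-pos v)
                                       (λ { {i , n} refl → B⇔C i n })

  Σ-⇔-nodeSets : {B : (I A → ℕ → Bool) → Set} {C : (Node A → Bool) → Set} →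
                 (∀ {W T} → W codesSet T → B W ⇔ C T) →
                 Σ (I A → ℕ → Bool) B ⇔ Σ (Node A → Bool) C
  Σ-⇔-nodeSets = Σ-⇔-related _codesSet_ (λ W → toNodeSet W , toNodeSet-node W)
                                         (λ T → (λ i → T ∘ node i) , λ i n → refl)

  Π-⇔-nodeSets : {B : (I A → ℕ → Bool) → Set} {C : (Node A → Bool) → Set} →
                 (∀ {W T} → W codesSet T → B W ⇔ C T) →
                 (∀ W → B W) ⇔ (∀ T → C T)
  Π-⇔-nodeSets = Π-⇔-related _codesSet_ (λ W → toNodeSet W , toNodeSet-node W)
                                         (λ T → (λ i → T ∘ node i) , λ i n → refl)

  module _ {F S : Set} where

    ⋁ᴵ ⋀ᴵ : (I A → MLO F S) → MLO F S
    ⋁ᴵ φ = ⋁ nQ λ q → φ (inj₁ q) ∨′ (φ (inj₂ (q , false)) ∨′ φ (inj₂ (q , true)))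
    ⋀ᴵ φ = ⋀ nQ λ q → φ (inj₁ q) ∧′ (φ (inj₂ (q , false)) ∧′ φ (inj₂ (q , true)))

    ⋁ᴵ-sat : ∀ φ ρ σ → satℕ (⋁ᴵ φ) ρ σ ⇔ ∃ λ i → satℕ (φ i) ρ σ
    ⋁ᴵ-sat φ ρ σ = ⇔.trans (⋁-sat nQ _ ρ σ) (mk⇔
      (λ { (q , inj₁ h)        → inj₁ q , h
         ; (q , inj₂ (inj₁ h)) → inj₂ (q , false) , h
         ; (q , inj₂ (inj₂ h)) → inj₂ (q , true) , h })
      (λ { (inj₁ q , h)          → q , inj₁ h
         ; (inj₂ (q , false) , h) → q , inj₂ (inj₁ h)
         ; (inj₂ (q , true) , h)  → q , inj₂ (inj₂ h) }))

    ⋀ᴵ-sat : ∀ φ ρ σ → satℕ (⋀ᴵ φ) ρ σ ⇔ (∀ i → satℕ (φ i) ρ σ)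
    ⋀ᴵ-sat φ ρ σ = ⇔.trans (⋀-sat nQ _ ρ σ) (mk⇔
      (λ { h (inj₁ q)          → proj₁ (h q)
         ; h (inj₂ (q , false)) → proj₁ (proj₂ (h q))
         ; h (inj₂ (q , true))  → proj₂ (proj₂ (h q)) })
      (λ h q → h (inj₁ q) , h (inj₂ (q , false)) , h (inj₂ (q , true))))

    ∃-node ∀-node : (I A → MLO (Maybe F) S) → MLO F S
    ∃-node φ = ⋁ᴵ λ i → ∃₁ (φ i)
    ∀-node φ = ⋀ᴵ λ i → ∀₁ (φ i)

    ∃-node-sat : ∀ φ ρ σ →
      satℕ (∃-node φ) ρ σ ⇔ Σ (I A × ℕ) λ (i , n) → satℕ (φ i) (maybe ρ n) σ
    ∃-node-sat φ ρ σ = ⇔.trans (⋁ᴵ-sat (λ i → ∃₁ (φ i)) ρ σ) (mk⇔ assocˡ assocʳ)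

    ∀-node-sat : ∀ φ ρ σ →
      satℕ (∀-node φ) ρ σ ⇔ (((i , n) : I A × ℕ) → satℕ (φ i) (maybe ρ n) σ)
    ∀-node-sat φ ρ σ = ⇔.trans (⋀ᴵ-sat (λ i → ∀₁ (φ i)) ρ σ) (mk⇔ (λ h (i , n) → h i n) (λ h i n → h (i , n)))

  -- The set variables of an MLO formula, extended by one fresh variable per i ∈ I.
  Extᴵ : Set → Set
  Extᴵ S = Ext nQ (Ext nQ (Ext nQ S))

  weakenᴵ : ∀ {S} → S → Extᴵ S
  weakenᴵ s = weaken nQ (weaken nQ (weaken nQ s))

  freshᴵ : ∀ {S} → I A → Extᴵ S
  freshᴵ (inj₁ q)           = weaken nQ (weaken nQ (fresh nQ q))
  freshᴵ (inj₂ (q , false)) = weaken nQ (fresh nQ q)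
  freshᴵ (inj₂ (q , true))  = fresh nQ q

  extendᴵ : ∀ {S X : Set} → (S → X) → (I A → X) → Extᴵ S → X
  extendᴵ σ W = extend nQ (extend nQ (extend nQ σ (W ∘ inj₁))
                                     (λ q → W (inj₂ (q , false))))
                          (λ q → W (inj₂ (q , true)))

  extendᴵ-weaken : ∀ {S X : Set} (σ : S → X) W s → extendᴵ σ W (weakenᴵ s) ≡ σ s
  extendᴵ-weaken σ W s =
    trans (extend-weaken nQ _ _ _) (trans (extend-weaken nQ _ _ _) (extend-weaken nQ _ _ _))

  extendᴵ-fresh : ∀ {S X : Set} (σ : S → X) W i → extendᴵ σ W (freshᴵ i) ≡ W i
  extendᴵ-fresh σ W (inj₁ q) =
    trans (extend-weaken nQ _ _ _) (trans (extend-weaken nQ _ _ _) (extend-fresh nQ _ _ q))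
  extendᴵ-fresh σ W (inj₂ (q , false)) = trans (extend-weaken nQ _ _ _) (extend-fresh nQ _ _ q)
  extendᴵ-fresh σ W (inj₂ (q , true))  = extend-fresh nQ _ _ q

  liftSlices : ∀ {S S′ : Set} → (S → I A → S′) → Maybe S → I A → Extᴵ S′
  liftSlices κ (just X) = weakenᴵ ∘ κ X
  liftSlices κ nothing  = freshᴵ

  module _ {F S : Set} where

    ∃ᴵ ∀ᴵ : MLO F (Extᴵ S) → MLO F S
    ∃ᴵ φ = ∃ⁿ nQ (∃ⁿ nQ (∃ⁿ nQ φ))
    ∀ᴵ φ = ∀ⁿ nQ (∀ⁿ nQ (∀ⁿ nQ φ))

    join : {X : Set} → Vector X nQ → Vector X nQ → Vector X nQ → I A → X
    join T₁ T₂ T₃ (inj₁ q)           = T₁ q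
    join T₁ T₂ T₃ (inj₂ (q , false)) = T₂ q
    join T₁ T₂ T₃ (inj₂ (q , true))  = T₃ q

    ∃ᴵ-sat : ∀ φ ρ σ →
      satℕ (∃ᴵ φ) ρ σ ⇔ Σ (I A → ℕ → Bool) λ W → satℕ φ ρ (extendᴵ σ W)
    ∃ᴵ-sat φ ρ σ = mk⇔
      (λ h₁ → let (T₁ , h₂) = to (∃ⁿ-sat nQ _ ρ σ) h₁
                  (T₂ , h₃) = to (∃ⁿ-sat nQ _ ρ _) h₂
                  (T₃ , h)  = to (∃ⁿ-sat nQ _ ρ _) h₃
              in join T₁ T₂ T₃ , h)
      (λ (W , h) → from (∃ⁿ-sat nQ _ ρ σ) (_ , from (∃ⁿ-sat nQ _ ρ _)
                                          (_ , from (∃ⁿ-sat nQ _ ρ _) (_ , h))))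

    ∀ᴵ-sat : ∀ φ ρ σ →
      satℕ (∀ᴵ φ) ρ σ ⇔ ((W : I A → ℕ → Bool) → satℕ φ ρ (extendᴵ σ W))
    ∀ᴵ-sat φ ρ σ = mk⇔
      (λ h W → to (∀ⁿ-sat nQ _ ρ _) (to (∀ⁿ-sat nQ _ ρ _) (to (∀ⁿ-sat nQ _ ρ σ) h _) _) _)
      (λ h → from (∀ⁿ-sat nQ _ ρ σ) λ T₁ → from (∀ⁿ-sat nQ _ ρ _) λ T₂ →
             from (∀ⁿ-sat nQ _ ρ _) λ T₃ → h (join T₁ T₂ T₃))

  module _ {F S : Set} where

    -- x and z have indices i and j; y holds P.
    edge : S → Bool → F → F → I A → I A → MLO F S
    edge y b x z (inj₁ q) (inj₂ (q′ , a′)) = ⌊ q Fin.≟ q′ ⌋′ ∧′ (⌊ a′ Bool.≟ b ⌋′ ∧′ (x ≐′ z))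
    edge y b x z (inj₂ (q , a)) (inj₁ q′) =
      isSucc x z ∧′ case∈ x y (λ c → ⌊ q′ Fin.≟ δ q (a , b , c) ⌋′)
    edge y b x z (inj₁ _) (inj₁ _) = ⊥′
    edge y b x z (inj₂ _) (inj₂ _) = ⊥′

  -- τ assigns an index to every node variable, κ X i is the MLO variable for
  -- the i-slice of the set variable X, and y is the variable for P.
  translate : ∀ {F S S′} (τ : F → I A) (κ : S → I A → S′) (y : S′) →
              MSO A F S → MLO F S′
  translate τ κ y (R i x)   = ⌊ τ x ≟ᴵ i ⌋′
  translate τ κ y (Init x)  = ⌊ τ x ≟ᴵ inj₁ qinit ⌋′ ∧′ isZero x
  translate τ κ y (Pr x)    = x ∈′ y
  translate τ κ y (x ≺ z)   = x <′ z
  translate τ κ y (E b x z) = edge y b x z (τ x) (τ z)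
  translate τ κ y (x ≐ z)   = ⌊ τ x ≟ᴵ τ z ⌋′ ∧′ (x ≐′ z)
  translate τ κ y (x ∈ X)   = x ∈′ κ X (τ x)
  translate τ κ y (¬′ ψ)    = ¬′ translate τ κ y ψ
  translate τ κ y (ψ ∧′ χ)  = translate τ κ y ψ ∧′ translate τ κ y χ
  translate τ κ y (ψ ∨′ χ)  = translate τ κ y ψ ∨′ translate τ κ y χ
  translate τ κ y (∃₁ ψ)    = ∃-node λ i → translate (maybe τ i) κ y ψ
  translate τ κ y (∀₁ ψ)    = ∀-node λ i → translate (maybe τ i) κ y ψ
  translate τ κ y (∃₂ ψ)    = ∃ᴵ (translate τ (liftSlices κ) (weakenᴵ y) ψ)
  translate τ κ y (∀₂ ψ)    = ∀ᴵ (translate τ (liftSlices κ) (weakenᴵ y) ψ)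

  module _ (P : ℕ → Bool) where

    ≡×≡⇔Edge₁ : ∀ b q q′ a′ n m →
                (q ≡ q′ × (a′ ≡ b × n ≡ m)) ⇔ Edge A P b (inj₁ (q , n)) (inj₂ (q′ , a′ , m))
    ≡×≡⇔Edge₁ b q q′ a′ n m = mk⇔ (λ { (refl , refl , refl) → edge₁ q b n })
                                   (λ { (edge₁ _ _ _) → refl , refl , refl })

    ≡×≡⇔Edge₂ : ∀ b q a q′ n m →
                (m ≡ suc n × q′ ≡ δ q (a , b , P n)) ⇔ Edge A P b (inj₂ (q , a , n)) (inj₁ (q′ , m))
    ≡×≡⇔Edge₂ b q a q′ n m = mk⇔ (λ { (refl , refl) → edge₂ q a b n })
                                  (λ { (edge₂ _ _ _ _) → refl , refl })

    edge-sat : ∀ {F S} (y : S) b x z i j (ρℕ : F → ℕ) (σℕ : S → ℕ → Bool) → σℕ y ≗ P →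
               satℕ (edge y b x z i j) ρℕ σℕ ⇔ Edge A P b (node i (ρℕ x)) (node j (ρℕ z))
    edge-sat y b x z (inj₁ q) (inj₂ (q′ , a′)) ρℕ σℕ _ =
      ⇔.trans (⌊⌋′-sat (q Fin.≟ q′) ρℕ σℕ ×-⇔ (⌊⌋′-sat (a′ Bool.≟ b) ρℕ σℕ ×-⇔ ⇔-id _))
              (≡×≡⇔Edge₁ b q q′ a′ (ρℕ x) (ρℕ z))
    edge-sat y b x z (inj₂ (q , a)) (inj₁ q′) ρℕ σℕ y≗P =
      ⇔.trans (isSucc-sat x z ρℕ σℕ ×-⇔ subst (λ c → _ ⇔ (q′ ≡ δ q (a , b , c))) (y≗P (ρℕ x))
                  (case∈-sat x y _ ρℕ σℕ _ λ c → ⌊⌋′-sat (q′ Fin.≟ δ q (a , b , c)) ρℕ σℕ))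
              (≡×≡⇔Edge₂ b q a q′ (ρℕ x) (ρℕ z))
    edge-sat y b x z (inj₁ _) (inj₁ _) ρℕ σℕ _ = mk⇔ (⊥-elim ∘ ⊥′-unsat ρℕ σℕ) λ ()
    edge-sat y b x z (inj₂ _) (inj₂ _) ρℕ σℕ _ = mk⇔ (⊥-elim ∘ ⊥′-unsat ρℕ σℕ) λ ()

    bind-node : ∀ {F : Set} {τ : F → I A} {ρℕ : F → ℕ} {ρ : F → Node A} →
                ρ ≗ (λ x → node (τ x) (ρℕ x)) →
                ∀ i n → maybe ρ (node i n) ≗ (λ x → node (maybe τ i x) (maybe ρℕ n x))
    bind-node ρ≗ i n nothing  = refl
    bind-node ρ≗ i n (just x) = ρ≗ x

    bind-P : ∀ {S} {σℕ : S → ℕ → Bool} {y : S} {W : I A → ℕ → Bool} →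
             σℕ y ≗ P → extendᴵ σℕ W (weakenᴵ y) ≗ P
    bind-P {σℕ = σℕ} {y} {W} y≗P n = trans (cong-app (extendᴵ-weaken σℕ W y) n) (y≗P n)

    bind-set : ∀ {S S′} {κ : S → I A → S′} {σℕ : S′ → ℕ → Bool} {σ : S → Node A → Bool}
                 {W : I A → ℕ → Bool} {T : Node A → Bool} →
               (∀ X → (σℕ ∘ κ X) codesSet σ X) → W codesSet T →
               ∀ X → (extendᴵ σℕ W ∘ liftSlices κ X) codesSet maybe σ T X
    bind-set {κ = κ} {σℕ} {W = W} κ≗ W≗T (just X) i n =
      trans (cong-app (extendᴵ-weaken σℕ W (κ X i)) n) (κ≗ X i n)
    bind-set {σℕ = σℕ} {W = W} κ≗ W≗T nothing i n =
      trans (cong-app (extendᴵ-fresh σℕ W i) n) (W≗T i n)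

    translate-sat : ∀ {F S S′} (τ : F → I A) (κ : S → I A → S′) (y : S′) (ψ : MSO A F S)
      (ρℕ : F → ℕ) (σℕ : S′ → ℕ → Bool) (ρ : F → Node A) (σ : S → Node A → Bool) →
      σℕ y ≗ P → (∀ X → (σℕ ∘ κ X) codesSet σ X) → ρ ≗ (λ x → node (τ x) (ρℕ x)) →
      satℕ (translate τ κ y ψ) ρℕ σℕ ⇔ sat A P ψ ρ σ
    translate-sat τ κ y (R i x) ρℕ σℕ ρ σ _ _ ρ≗ rewrite ρ≗ x =
      ⇔.trans (⌊⌋′-sat (τ x ≟ᴵ i) ρℕ σℕ) (≡⇔Rel-node (τ x) i (ρℕ x))
    translate-sat τ κ y (Init x) ρℕ σℕ ρ σ _ _ ρ≗ rewrite ρ≗ x =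
      ⇔.trans (⌊⌋′-sat (τ x ≟ᴵ inj₁ qinit) ρℕ σℕ ×-⇔ isZero-sat x ρℕ σℕ)
              (≡×≡⇔node≡node (τ x) (inj₁ qinit) (ρℕ x) 0)
    translate-sat τ κ y (Pr x) ρℕ σℕ ρ σ y≗P _ ρ≗
      rewrite ρ≗ x | pos-node (τ x) (ρℕ x) | y≗P (ρℕ x) = ⇔-id _
    translate-sat τ κ y (x ≺ z) ρℕ σℕ ρ σ _ _ ρ≗
      rewrite ρ≗ x | ρ≗ z | pos-node (τ x) (ρℕ x) | pos-node (τ z) (ρℕ z) = ⇔-id _
    translate-sat τ κ y (E b x z) ρℕ σℕ ρ σ y≗P _ ρ≗ rewrite ρ≗ x | ρ≗ z =
      edge-sat y b x z (τ x) (τ z) ρℕ σℕ y≗P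
    translate-sat τ κ y (x ≐ z) ρℕ σℕ ρ σ _ _ ρ≗ rewrite ρ≗ x | ρ≗ z =
      ⇔.trans (⌊⌋′-sat (τ x ≟ᴵ τ z) ρℕ σℕ ×-⇔ ⇔-id _)
              (≡×≡⇔node≡node (τ x) (τ z) (ρℕ x) (ρℕ z))
    translate-sat τ κ y (x ∈ X) ρℕ σℕ ρ σ _ κ≗ ρ≗
      rewrite ρ≗ x | κ≗ X (τ x) (ρℕ x) = ⇔-id _
    translate-sat τ κ y (¬′ ψ) ρℕ σℕ ρ σ y≗P κ≗ ρ≗ =
      ¬-cong-⇔ (translate-sat τ κ y ψ ρℕ σℕ ρ σ y≗P κ≗ ρ≗)
    translate-sat τ κ y (ψ ∧′ χ) ρℕ σℕ ρ σ y≗P κ≗ ρ≗ =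
      translate-sat τ κ y ψ ρℕ σℕ ρ σ y≗P κ≗ ρ≗ ×-⇔ translate-sat τ κ y χ ρℕ σℕ ρ σ y≗P κ≗ ρ≗
    translate-sat τ κ y (ψ ∨′ χ) ρℕ σℕ ρ σ y≗P κ≗ ρ≗ =
      translate-sat τ κ y ψ ρℕ σℕ ρ σ y≗P κ≗ ρ≗ ⊎-⇔ translate-sat τ κ y χ ρℕ σℕ ρ σ y≗P κ≗ ρ≗
    translate-sat τ κ y (∃₁ ψ) ρℕ σℕ ρ σ y≗P κ≗ ρ≗ =
      ⇔.trans (∃-node-sat _ ρℕ σℕ) (Σ-⇔-nodes λ i n →
        translate-sat (maybe τ i) κ y ψ _ σℕ _ σ y≗P κ≗ (bind-node ρ≗ i n))
    translate-sat τ κ y (∀₁ ψ) ρℕ σℕ ρ σ y≗P κ≗ ρ≗ =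
      ⇔.trans (∀-node-sat _ ρℕ σℕ) (Π-⇔-nodes λ i n →
        translate-sat (maybe τ i) κ y ψ _ σℕ _ σ y≗P κ≗ (bind-node ρ≗ i n))
    translate-sat τ κ y (∃₂ ψ) ρℕ σℕ ρ σ y≗P κ≗ ρ≗ =
      ⇔.trans (∃ᴵ-sat _ ρℕ σℕ) (Σ-⇔-nodeSets λ {W} {T} W≗T →
        translate-sat τ (liftSlices κ) (weakenᴵ y) ψ ρℕ (extendᴵ σℕ W) ρ (maybe σ T)
                      (bind-P {W = W} y≗P) (bind-set κ≗ W≗T) ρ≗)
    translate-sat τ κ y (∀₂ ψ) ρℕ σℕ ρ σ y≗P κ≗ ρ≗ =
      ⇔.trans (∀ᴵ-sat _ ρℕ σℕ) (Π-⇔-nodeSets λ {W} {T} W≗T →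
        translate-sat τ (liftSlices κ) (weakenᴵ y) ψ ρℕ (extendᴵ σℕ W) ρ (maybe σ T)
                      (bind-P {W = W} y≗P) (bind-set κ≗ W≗T) ρ≗)

lemma6p6 : Σ ((A : DPA) → (k : ℕ) → MSO A ⊥ (Fin k) → MLO ⊥ (Maybe (Fin k × I A))) λ tr →
    (A : DPA) (k : ℕ) (ψ : MSO A ⊥ (Fin k)) (P : ℕ → Bool) (W : Fin k → I A → ℕ → Bool) →
    satℕ (tr A k ψ) noVars (mloEnv {A} {k} P W) ⇔ sat A P ψ noVars (λ j → toNodeSet {A} (W j))
lemma6p6 = (λ A k → translate A noVars (λ X i → just (X , i)) nothing) ,
  λ A k ψ P W → translate-sat A P noVars (λ X i → just (X , i)) nothing ψ
                               noVars (mloEnv P W) noVars (λ j → toNodeSet (W j))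
                               (λ _ → refl) (λ X → toNodeSet-node A (W X)) (λ ())
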